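{- Write $Q:= 3^\ell$ for some $\ell\ge 3$. Let $n_1,n_2,n_3,n_5,n_9$ be nonnegative integers for which $n_1+2n_2+3n_3+5n_5+9n_9=Q-1$ and the union of the base-$3$ expansions of the $n_j$'s consists of one copy of each $3^i$ with $1\le i\le\ell-2$ along with some partition of $2$. Then the base-$3$ expansion of $n_5$ contains $Q/9$, and the base-$3$ expansion of $n_9$ contains $Q/27$.
   Context: A term of the base-$p$ expansion of a nonnegative integer $m=\sum_j b_jp^j$ ($0\le b_j\le p-1$) is some $b_jp^j$ with $b_j>0$; the union of the base-$p$ expansions of several integers means the multiset of all terms of all of them. -}

module Defs where

open import Data.Nat using (ℕ; suc; _^_; _*_; _<_; NonZero; _≟_)
open import Data.Nat.DivMod using (_/_; _%_)
open import Data.Nat.Properties using (m^n≢0)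
open import Data.List using (List; map; filter; upTo)
open import Data.Nat.ListAction using (sum)
open import Data.List.Relation.Unary.All using (All)
open import Data.Product using (_×_)
open import Relation.Nullary using (¬?)
open import Relation.Binary.PropositionalEquality using (_≡_)

digit : (p : ℕ) .{{_ : NonZero p}} → ℕ → ℕ → ℕ
digit p m j = (_/_ m (p ^ j) {{m^n≢0 p j}}) % p

-- The terms b_j p^j (with b_j > 0) of the base-p expansion of m, as a list
-- (positions j ≤ m suffice, since p^j > m for j > m when p ≥ 2).
terms : (p : ℕ) .{{_ : NonZero p}} → ℕ → List ℕ
terms p m = map (λ j → digit p m j * p ^ j)
                (filter (λ j → ¬? (digit p m j ≟ 0)) (upTo (suc m)))

IsPartition : ℕ → List ℕ → Set
IsPartition n P = All (0 <_) P × sum P ≡ n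

-- Write X = Q/27.  The terms add up to (Q/3 − 3)/2 + 2, so the parts satisfy
-- 2(n₁+n₂+n₃+n₅+n₉) = 9X + 1, while the weighted sum is 27X − 1.  Eliminating,
-- 12(n₁+n₂+n₃) + 8n₅ + (4n₁ + 2n₂) = 27X + 11, which is below 32X once X ≥ 3.
-- Hence the term 3X = Q/9 lies neither in n₉ (9n₉ < 27X) nor in n₁, n₂, n₃
-- (cost 36X), so it lies in n₅; then X lies neither in n₁, n₂, n₃ (cost
-- 12X + 24X) nor next to 3X in n₅ (cost 32X), so it lies in n₉.
module Submission where

open import Defs
open import Data.Nat using (ℕ; suc; _+_; _*_; _∸_; _^_; _≤_; _/_)
open import Data.List using (List; map; upTo; _++_)
open import Data.List.Membership.Propositional using (_∈_)
open import Data.List.Relation.Binary.Permutation.Propositional using (_↭_)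
open import Data.Product using (Σ; _×_)
open import Relation.Binary.PropositionalEquality using (_≡_)

open import Data.Nat using (zero; _<_; _≟_; NonZero; z≤n; s≤s)
open import Data.Nat.Properties
open import Data.Nat.DivMod
open import Data.Nat.Divisibility using (n∣m*n)
open import Data.Nat.ListAction using (sum)
open import Data.Nat.ListAction.Properties using (sum-++; sum-↭)
open import Data.List using (_∷_; []; [_]; filter; _∷ʳ_)
open import Data.List.Properties using (map-++; applyUpTo-∷ʳ)
open import Data.List.Membership.Propositional.Properties using (∈-++⁻; ∈-++⁺ˡ; ∈-map⁺; ∈-upTo⁺)
open import Data.List.Relation.Unary.Any using (here; there)
open import Data.List.Relation.Binary.Permutation.Propositional using (↭-sym)
open import Data.List.Relation.Binary.Permutation.Propositional.Properties using (∈-resp-↭)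
open import Data.Product using (_,_)
open import Data.Sum using (_⊎_; inj₁; inj₂)
open import Data.Empty using (⊥; ⊥-elim)
open import Function using (id; _∘_)
open import Data.Nat.Tactic.RingSolver using (solve-∀)
open import Relation.Nullary using (¬_; ¬?; Dec; yes; no)
open import Relation.Nullary.Decidable using (decidable-stable; toWitness; _→-dec_; _×-dec_)
open import Data.List.Membership.DecPropositional _≟_ using (_∈?_)
open import Relation.Binary.PropositionalEquality using (_≢_; refl; sym; trans; cong; cong₂; subst; subst₂; module ≡-Reasoning)

sum-map-filter : ∀ {A : Set} {P : A → Set} (P? : ∀ x → Dec (P x)) (f : A → ℕ)
  → (∀ x → ¬ P x → f x ≡ 0) → ∀ xs → sum (map f (filter P? xs)) ≡ sum (map f xs)
sum-map-filter P? f f≡0 [] = refl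
sum-map-filter P? f f≡0 (x ∷ xs) with P? x
... | yes _ = cong (f x +_) (sum-map-filter P? f f≡0 xs)
... | no ¬Px rewrite f≡0 x ¬Px = sum-map-filter P? f f≡0 xs

n<m^n : ∀ {m} → 1 < m → ∀ n → n < m ^ n
n<m^n 1<m zero = s≤s z≤n
n<m^n {m@(suc _)} 1<m (suc n) = begin-strict
  suc n      ≤⟨ n<m^n 1<m n ⟩
  m ^ n      <⟨ m<m*n (m ^ n) m 1<m ⟩
  m ^ n * m  ≡⟨ *-comm (m ^ n) m ⟩
  m * m ^ n  ∎
  where
  open ≤-Reasoning
  instance _ = m^n≢0 m n

sum-map-upTo-suc : ∀ (f : ℕ → ℕ) k → sum (map f (upTo (suc k))) ≡ sum (map f (upTo k)) + f k
sum-map-upTo-suc f k = begin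
  sum (map f (upTo (suc k)))       ≡⟨ cong (sum ∘ map f) (sym (applyUpTo-∷ʳ id k)) ⟩
  sum (map f (upTo k ∷ʳ k))        ≡⟨ cong sum (map-++ f (upTo k) [ k ]) ⟩
  sum (map f (upTo k) ∷ʳ f k)      ≡⟨ sum-++ (map f (upTo k)) [ f k ] ⟩
  sum (map f (upTo k)) + (f k + 0) ≡⟨ cong (sum (map f (upTo k)) +_) (+-identityʳ (f k)) ⟩
  sum (map f (upTo k)) + f k       ∎
  where open ≡-Reasoning

m%[n*o]≡m%o+[m/o%n]*o : ∀ m n o .{{_ : NonZero n}} .{{_ : NonZero o}} {{_ : NonZero (n * o)}}
  → m % (n * o) ≡ m % o + m / o % n * o
m%[n*o]≡m%o+[m/o%n]*o m n o = begin
  m % (n * o)                            ≡⟨ m≡m%n+[m/n]*n (m % (n * o)) o ⟩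
  m % (n * o) % o + m % (n * o) / o * o  ≡⟨ cong₂ (λ r s → r + s * o)
                                              (m∣n⇒o%n%m≡o%m o (n * o) m (n∣m*n n))
                                              (m%[n*o]/o≡m/o%n m n o) ⟩
  m % o + m / o % n * o                  ∎
  where open ≡-Reasoning

∈⇒≤sum : ∀ {x xs} → x ∈ xs → x ≤ sum xs
∈⇒≤sum {xs = y ∷ ys} (here refl) = m≤m+n y (sum ys)
∈⇒≤sum {xs = y ∷ ys} (there x∈ys) = m≤n⇒m≤o+n y (∈⇒≤sum x∈ys)

∈-≢⇒+≤sum : ∀ {x y xs} → x ∈ xs → y ∈ xs → x ≢ y → x + y ≤ sum xs
∈-≢⇒+≤sum (here refl) (here refl) x≢y = ⊥-elim (x≢y refl)
∈-≢⇒+≤sum {x} (here refl) (there y∈) _ = +-monoʳ-≤ x (∈⇒≤sum y∈)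
∈-≢⇒+≤sum {x} {y} {z ∷ zs} (there x∈) (here refl) _ = subst (_≤ y + sum zs) (+-comm y x) (+-monoʳ-≤ y (∈⇒≤sum x∈))
∈-≢⇒+≤sum {xs = z ∷ zs} (there x∈) (there y∈) x≢y = m≤n⇒m≤o+n z (∈-≢⇒+≤sum x∈ y∈ x≢y)

module _ (p : ℕ) .{{_ : NonZero p}} where

  sum-digits-upTo : ∀ n k {{_ : NonZero (p ^ k)}}
    → sum (map (λ j → digit p n j * p ^ j) (upTo k)) ≡ n % p ^ k
  sum-digits-upTo n zero = sym (n%1≡0 n)
  sum-digits-upTo n (suc k) = begin
    sum (map term (upTo (suc k)))      ≡⟨ sum-map-upTo-suc term k ⟩
    sum (map term (upTo k)) + term k   ≡⟨ cong (_+ term k) (sum-digits-upTo n k) ⟩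
    n % p ^ k + term k                 ≡⟨ sym (m%[n*o]≡m%o+[m/o%n]*o n p (p ^ k)) ⟩
    n % p ^ suc k                      ∎
    where
    open ≡-Reasoning
    instance _ = m^n≢0 p k
    term : ℕ → ℕ
    term j = digit p n j * p ^ j

  sum-terms : 1 < p → ∀ n → sum (terms p n) ≡ n
  sum-terms 1<p n = begin
    sum (terms p n)               ≡⟨ sum-map-filter (λ j → ¬? (digit p n j ≟ 0)) term zero-digit (upTo (suc n)) ⟩
    sum (map term (upTo (suc n))) ≡⟨ sum-digits-upTo n (suc n) ⟩
    n % p ^ suc n                 ≡⟨ m<n⇒m%n≡m (<-≤-trans (n<m^n 1<p n) (^-monoʳ-≤ p (n≤1+n n))) ⟩
    n                             ∎
    where
    open ≡-Reasoning
    instance _ = m^n≢0 p (suc n)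
    term : ℕ → ℕ
    term j = digit p n j * p ^ j
    zero-digit : ∀ j → ¬ ¬ digit p n j ≡ 0 → term j ≡ 0
    zero-digit j ¬digit≢0 = cong (_* p ^ j) (decidable-stable (digit p n j ≟ 0) ¬digit≢0)

  ∈-terms⇒≤ : 1 < p → ∀ {t n} → t ∈ terms p n → t ≤ n
  ∈-terms⇒≤ 1<p {t} {n} t∈ = subst (t ≤_) (sum-terms 1<p n) (∈⇒≤sum t∈)

sum-powers : ∀ q m → q * sum (map (λ i → suc q ^ suc i) (upTo m)) + suc q ≡ suc q ^ suc m
sum-powers q zero = trans (cong (_+ suc q) (*-zeroʳ q)) (sym (*-identityʳ (suc q)))
sum-powers q (suc m) = begin
  q * sum (map power (upTo (suc m))) + suc q       ≡⟨ cong (λ s → q * s + suc q) (sum-map-upTo-suc power m) ⟩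
  q * (sum (map power (upTo m)) + r) + suc q       ≡⟨ regroup q (sum (map power (upTo m))) r ⟩
  (q * sum (map power (upTo m)) + suc q) + q * r   ≡⟨ cong (_+ q * r) (sum-powers q m) ⟩
  r + q * r                                        ∎
  where
  open ≡-Reasoning
  power : ℕ → ℕ
  power i = suc q ^ suc i
  r = suc q ^ suc m
  regroup : ∀ q s r → q * (s + r) + suc q ≡ (q * s + suc q) + q * r
  regroup = solve-∀

1<3 : 1 < 3
1<3 = s≤s (s≤s z≤n)

expansions : ℕ → ℕ → ℕ → ℕ → ℕ → List ℕ
expansions n₁ n₂ n₃ n₅ n₉ = terms 3 n₁ ++ terms 3 n₂ ++ terms 3 n₃ ++ terms 3 n₅ ++ terms 3 n₉

sum-expansions : ∀ n₁ n₂ n₃ n₅ n₉ → sum (expansions n₁ n₂ n₃ n₅ n₉) ≡ n₁ + (n₂ + (n₃ + (n₅ + n₉)))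
sum-expansions n₁ n₂ n₃ n₅ n₉ =
  trans (sum-terms-++ n₁ _) (cong (n₁ +_)
  (trans (sum-terms-++ n₂ _) (cong (n₂ +_)
  (trans (sum-terms-++ n₃ _) (cong (n₃ +_)
  (trans (sum-terms-++ n₅ _) (cong (n₅ +_) (sum-terms-3 n₉))))))))
  where
  sum-terms-3 : ∀ n → sum (terms 3 n) ≡ n
  sum-terms-3 = sum-terms 3 1<3
  sum-terms-++ : ∀ n xs → sum (terms 3 n ++ xs) ≡ n + sum xs
  sum-terms-++ n xs = trans (sum-++ (terms 3 n) xs) (cong (_+ sum xs) (sum-terms-3 n))

∈-expansions⁻ : ∀ {t} n₁ n₂ n₃ n₅ n₉ → t ∈ expansions n₁ n₂ n₃ n₅ n₉
  → t ≤ n₁ + n₂ + n₃ ⊎ t ∈ terms 3 n₅ ⊎ t ∈ terms 3 n₉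
∈-expansions⁻ n₁ n₂ n₃ n₅ n₉ t∈ with ∈-++⁻ (terms 3 n₁) t∈
... | inj₁ t∈n₁ = inj₁ (≤-trans (∈-terms⇒≤ 3 1<3 t∈n₁) (≤-trans (m≤m+n n₁ n₂) (m≤m+n _ n₃)))
... | inj₂ t∈ with ∈-++⁻ (terms 3 n₂) t∈
...   | inj₁ t∈n₂ = inj₁ (≤-trans (∈-terms⇒≤ 3 1<3 t∈n₂) (≤-trans (m≤n+m n₂ n₁) (m≤m+n _ n₃)))
...   | inj₂ t∈ with ∈-++⁻ (terms 3 n₃) t∈
...     | inj₁ t∈n₃ = inj₁ (≤-trans (∈-terms⇒≤ 3 1<3 t∈n₃) (m≤n+m n₃ (n₁ + n₂)))
...     | inj₂ t∈ = inj₂ (∈-++⁻ (terms 3 n₅) t∈)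

light-bound : ∀ X n₁ n₂ n₃ n₅ n₉
  → n₁ + 2 * n₂ + 3 * n₃ + 5 * n₅ + 9 * n₉ + 1 ≡ 27 * X
  → 2 * (n₁ + (n₂ + (n₃ + (n₅ + n₉)))) ≡ 9 * X + 1
  → 12 * (n₁ + n₂ + n₃) + 8 * n₅ ≤ 27 * X + 11
light-bound X n₁ n₂ n₃ n₅ n₉ weighted count = +-cancelˡ-≤ (54 * X) _ _ (begin
  54 * X + V                ≤⟨ +-monoʳ-≤ (54 * X) (m≤m+n V W) ⟩
  54 * X + (V + W)          ≡⟨ cong (_+ (V + W)) (*-assoc 2 27 X) ⟩
  2 * (27 * X) + (V + W)    ≡⟨ cong (λ s → 2 * s + (V + W)) (sym weighted) ⟩
  2 * (S + 1) + (V + W)     ≡⟨ eliminate n₁ n₂ n₃ n₅ n₉ ⟩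
  9 * (2 * T) + 2           ≡⟨ cong (λ s → 9 * s + 2) count ⟩
  9 * (9 * X + 1) + 2       ≡⟨ rearrange X ⟩
  54 * X + (27 * X + 11)    ∎)
  where
  open ≤-Reasoning
  S = n₁ + 2 * n₂ + 3 * n₃ + 5 * n₅ + 9 * n₉
  T = n₁ + (n₂ + (n₃ + (n₅ + n₉)))
  V = 12 * (n₁ + n₂ + n₃) + 8 * n₅
  W = 4 * n₁ + 2 * n₂
  eliminate : ∀ n₁ n₂ n₃ n₅ n₉
    → 2 * ((n₁ + 2 * n₂ + 3 * n₃ + 5 * n₅ + 9 * n₉) + 1) + ((12 * (n₁ + n₂ + n₃) + 8 * n₅) + (4 * n₁ + 2 * n₂))
      ≡ 9 * (2 * (n₁ + (n₂ + (n₃ + (n₅ + n₉))))) + 2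
  eliminate = solve-∀
  rearrange : ∀ X → 9 * (9 * X + 1) + 2 ≡ 54 * X + (27 * X + 11)
  rearrange = solve-∀

m≤27*X+11⇒m<32*X : ∀ {X m} → 3 ≤ X → m ≤ 27 * X + 11 → m < 32 * X
m≤27*X+11⇒m<32*X {X} {m} 3≤X m≤ = begin-strict
  m              ≤⟨ m≤ ⟩
  27 * X + 11    <⟨ +-monoʳ-< (27 * X) (≤-trans (m≤m+n 12 3) (*-monoʳ-≤ 5 3≤X)) ⟩
  27 * X + 5 * X ≡⟨ sym (*-distribʳ-+ X 27 5) ⟩
  32 * X         ∎
  where open ≤-Reasoning

n₉<3*X : ∀ X n₁ n₂ n₃ n₅ n₉ → n₁ + 2 * n₂ + 3 * n₃ + 5 * n₅ + 9 * n₉ + 1 ≡ 27 * X → n₉ < 3 * X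
n₉<3*X X n₁ n₂ n₃ n₅ n₉ weighted = *-cancelˡ-< 9 n₉ (3 * X) (begin-strict
  9 * n₉              ≤⟨ m≤n+m (9 * n₉) (n₁ + 2 * n₂ + 3 * n₃ + 5 * n₅) ⟩
  S                   <⟨ n<1+n S ⟩
  suc S               ≡⟨ +-comm 1 S ⟩
  S + 1               ≡⟨ weighted ⟩
  27 * X              ≡⟨ *-assoc 9 3 X ⟩
  9 * (3 * X)         ∎)
  where
  open ≤-Reasoning
  S = n₁ + 2 * n₂ + 3 * n₃ + 5 * n₅ + 9 * n₉

placement : ∀ {X} n₁ n₂ n₃ n₅ n₉ → 0 < X
  → 12 * (n₁ + n₂ + n₃) + 8 * n₅ < 32 * X → n₉ < 3 * X
  → 3 * X ∈ expansions n₁ n₂ n₃ n₅ n₉ → X ∈ expansions n₁ n₂ n₃ n₅ n₉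
  → 3 * X ∈ terms 3 n₅ × X ∈ terms 3 n₉
placement {X} n₁ n₂ n₃ n₅ n₉ 0<X light heavy 3X∈ X∈ =
  place (∈-expansions⁻ n₁ n₂ n₃ n₅ n₉ 3X∈) (∈-expansions⁻ n₁ n₂ n₃ n₅ n₉ X∈)
  where
  u = n₁ + n₂ + n₃
  Position : ℕ → Set
  Position t = t ≤ u ⊎ t ∈ terms 3 n₅ ⊎ t ∈ terms 3 n₉

  too-heavy : 32 * X ≤ 12 * u + 8 * n₅ → ⊥
  too-heavy = <⇒≱ light

  lower₁ : 3 * X ≤ u → 32 * X ≤ 12 * u + 8 * n₅
  lower₁ 3X≤u = begin
    32 * X          ≤⟨ *-monoˡ-≤ X (m≤m+n 32 4) ⟩
    36 * X          ≡⟨ *-assoc 12 3 X ⟩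
    12 * (3 * X)    ≤⟨ *-monoʳ-≤ 12 3X≤u ⟩
    12 * u          ≤⟨ m≤m+n (12 * u) (8 * n₅) ⟩
    12 * u + 8 * n₅ ∎
    where open ≤-Reasoning

  lower₂ : X ≤ u → 3 * X ≤ n₅ → 32 * X ≤ 12 * u + 8 * n₅
  lower₂ X≤u 3X≤n₅ = begin
    32 * X                ≤⟨ *-monoˡ-≤ X (m≤m+n 32 4) ⟩
    36 * X                ≡⟨ *-distribʳ-+ X 12 24 ⟩
    12 * X + 24 * X       ≡⟨ cong (12 * X +_) (*-assoc 8 3 X) ⟩
    12 * X + 8 * (3 * X)  ≤⟨ +-mono-≤ (*-monoʳ-≤ 12 X≤u) (*-monoʳ-≤ 8 3X≤n₅) ⟩
    12 * u + 8 * n₅       ∎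
    where open ≤-Reasoning

  lower₃ : 3 * X + X ≤ n₅ → 32 * X ≤ 12 * u + 8 * n₅
  lower₃ 4X≤n₅ = begin
    32 * X                ≡⟨ *-assoc 8 4 X ⟩
    8 * (4 * X)           ≡⟨ cong (8 *_) (+-comm X (3 * X)) ⟩
    8 * (3 * X + X)       ≤⟨ *-monoʳ-≤ 8 4X≤n₅ ⟩
    8 * n₅                ≤⟨ m≤n+m (8 * n₅) (12 * u) ⟩
    12 * u + 8 * n₅       ∎
    where open ≤-Reasoning

  3X+X≤n₅ : 3 * X ∈ terms 3 n₅ → X ∈ terms 3 n₅ → 3 * X + X ≤ n₅
  3X+X≤n₅ 3X∈n₅ X∈n₅ = subst (3 * X + X ≤_) (sum-terms 3 1<3 n₅)
    (∈-≢⇒+≤sum 3X∈n₅ X∈n₅ (>⇒≢ (m<m+n X (≤-trans 0<X (m≤m+n X _)))))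

  place : Position (3 * X) → Position X → 3 * X ∈ terms 3 n₅ × X ∈ terms 3 n₉
  place (inj₁ 3X≤u)          _                  = ⊥-elim (too-heavy (lower₁ 3X≤u))
  place (inj₂ (inj₂ 3X∈n₉))  _                  = ⊥-elim (<⇒≱ heavy (∈-terms⇒≤ 3 1<3 3X∈n₉))
  place (inj₂ (inj₁ 3X∈n₅)) (inj₁ X≤u)         = ⊥-elim (too-heavy (lower₂ X≤u (∈-terms⇒≤ 3 1<3 3X∈n₅)))
  place (inj₂ (inj₁ 3X∈n₅)) (inj₂ (inj₁ X∈n₅)) = ⊥-elim (too-heavy (lower₃ (3X+X≤n₅ 3X∈n₅ X∈n₅)))
  place (inj₂ (inj₁ 3X∈n₅)) (inj₂ (inj₂ X∈n₉)) = 3X∈n₅ , X∈n₉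

-- For ℓ = 3 the term X = 1 may come from the partition of 2, so the argument
-- above does not apply; the five parts are at most 5 and are checked exhaustively.
SmallCase : ℕ → ℕ → ℕ → ℕ → ℕ → Set
SmallCase n₁ n₂ n₃ n₅ n₉ =
  2 * (n₁ + (n₂ + (n₃ + (n₅ + n₉)))) ≡ 10 → n₁ + 2 * n₂ + 3 * n₃ + 5 * n₅ + 9 * n₉ + 1 ≡ 27
  → 3 ∈ expansions n₁ n₂ n₃ n₅ n₉ → 3 ∈ terms 3 n₅ × 1 ∈ terms 3 n₉

small-case? : ∀ n₁ n₂ n₃ n₅ n₉ → Dec (SmallCase n₁ n₂ n₃ n₅ n₉)
small-case? n₁ n₂ n₃ n₅ n₉ =
  (2 * (n₁ + (n₂ + (n₃ + (n₅ + n₉)))) ≟ 10) →-dec (n₁ + 2 * n₂ + 3 * n₃ + 5 * n₅ + 9 * n₉ + 1 ≟ 27)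
  →-dec (3 ∈? expansions n₁ n₂ n₃ n₅ n₉) →-dec ((3 ∈? terms 3 n₅) ×-dec (1 ∈? terms 3 n₉))

small-case-table : ∀ {n₁} → n₁ < 6 → ∀ {n₂} → n₂ < 6 → ∀ {n₃} → n₃ < 6 → ∀ {n₅} → n₅ < 6 → ∀ {n₉} → n₉ < 6
  → SmallCase n₁ n₂ n₃ n₅ n₉
small-case-table = toWitness {a? = all₆? λ n₁ → all₆? λ n₂ → all₆? λ n₃ → all₆? λ n₅ → all₆? λ n₉ → small-case? n₁ n₂ n₃ n₅ n₉} _
  where
  all₆? : ∀ {P : ℕ → Set} → (∀ n → Dec (P n)) → Dec (∀ {n} → n < 6 → P n)
  all₆? P? = allUpTo? P? 6

small-case : ∀ n₁ n₂ n₃ n₅ n₉ → SmallCase n₁ n₂ n₃ n₅ n₉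
small-case n₁ n₂ n₃ n₅ n₉ count =
  small-case-table (bound (m≤m+n n₁ _))
                   (bound (m≤n⇒m≤o+n n₁ (m≤m+n n₂ _)))
                   (bound (m≤n⇒m≤o+n n₁ (m≤n⇒m≤o+n n₂ (m≤m+n n₃ _))))
                   (bound (m≤n⇒m≤o+n n₁ (m≤n⇒m≤o+n n₂ (m≤n⇒m≤o+n n₃ (m≤m+n n₅ n₉)))))
                   (bound (m≤n⇒m≤o+n n₁ (m≤n⇒m≤o+n n₂ (m≤n⇒m≤o+n n₃ (m≤n+m n₉ n₅)))))
                   count
  where
  T = n₁ + (n₂ + (n₃ + (n₅ + n₉)))
  bound : ∀ {n} → n ≤ T → n < 6
  bound n≤T = s≤s (≤-trans n≤T (*-cancelˡ-≤ 2 (≤-reflexive count)))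

placement-3^k : ∀ k n₁ n₂ n₃ n₅ n₉
  → n₁ + 2 * n₂ + 3 * n₃ + 5 * n₅ + 9 * n₉ + 1 ≡ 27 * 3 ^ k
  → 2 * (n₁ + (n₂ + (n₃ + (n₅ + n₉)))) ≡ 9 * 3 ^ k + 1
  → (∀ {i} → i < suc k → 3 ^ suc i ∈ expansions n₁ n₂ n₃ n₅ n₉)
  → 3 * 3 ^ k ∈ terms 3 n₅ × 3 ^ k ∈ terms 3 n₉
placement-3^k zero n₁ n₂ n₃ n₅ n₉ weighted count powers∈ =
  small-case n₁ n₂ n₃ n₅ n₉ count weighted (powers∈ (s≤s z≤n))
placement-3^k (suc j) n₁ n₂ n₃ n₅ n₉ weighted count powers∈ =
  placement n₁ n₂ n₃ n₅ n₉ (m^n>0 3 (suc j))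
            (m≤27*X+11⇒m<32*X (*-monoʳ-≤ 3 (m^n>0 3 j)) (light-bound X n₁ n₂ n₃ n₅ n₉ weighted count))
            (n₉<3*X X n₁ n₂ n₃ n₅ n₉ weighted)
            (powers∈ (n<1+n (suc j)))
            (powers∈ (m≤n⇒m≤1+n (n<1+n j)))
  where X = 3 ^ suc j

count-of-parts : ∀ k n₁ n₂ n₃ n₅ n₉ P
  → expansions n₁ n₂ n₃ n₅ n₉ ↭ map (λ i → 3 ^ suc i) (upTo (suc k)) ++ P → sum P ≡ 2
  → 2 * (n₁ + (n₂ + (n₃ + (n₅ + n₉)))) ≡ 9 * 3 ^ k + 1
count-of-parts k n₁ n₂ n₃ n₅ n₉ P expansions↭ sum-P≡2 = begin
  2 * (n₁ + (n₂ + (n₃ + (n₅ + n₉)))) ≡⟨ cong (2 *_) (sym (sum-expansions n₁ n₂ n₃ n₅ n₉)) ⟩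
  2 * sum (expansions n₁ n₂ n₃ n₅ n₉) ≡⟨ cong (2 *_) (sum-↭ expansions↭) ⟩
  2 * sum (powers ++ P)              ≡⟨ cong (2 *_) (sum-++ powers P) ⟩
  2 * (sum powers + sum P)           ≡⟨ cong (λ s → 2 * (sum powers + s)) sum-P≡2 ⟩
  2 * (sum powers + 2)               ≡⟨ double (sum powers) ⟩
  (2 * sum powers + 3) + 1           ≡⟨ cong (_+ 1) (sum-powers 2 (suc k)) ⟩
  3 ^ (2 + k) + 1                    ≡⟨ cong (_+ 1) (^-distribˡ-+-* 3 2 k) ⟩
  9 * 3 ^ k + 1                      ∎
  where
  open ≡-Reasoning
  powers = map (λ i → 3 ^ suc i) (upTo (suc k))
  double : ∀ s → 2 * (s + 2) ≡ (2 * s + 3) + 1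
  double = solve-∀

lemma4p1 : (ℓ : ℕ) → 3 ≤ ℓ → (n₁ n₂ n₃ n₅ n₉ : ℕ)
    → n₁ + 2 * n₂ + 3 * n₃ + 5 * n₅ + 9 * n₉ ≡ 3 ^ ℓ ∸ 1
    → Σ (List ℕ) (λ P → IsPartition 2 P
        × ((terms 3 n₁ ++ terms 3 n₂ ++ terms 3 n₃ ++ terms 3 n₅ ++ terms 3 n₉)
           ↭ (map (λ i → 3 ^ suc i) (upTo (ℓ ∸ 2)) ++ P)))
    → ((3 ^ ℓ) / 9 ∈ terms 3 n₅) × ((3 ^ ℓ) / 27 ∈ terms 3 n₉)
lemma4p1 (suc (suc (suc k))) (s≤s (s≤s (s≤s _))) n₁ n₂ n₃ n₅ n₉ weighted (P , (_ , sum-P≡2) , expansions↭) =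
  subst₂ (λ t₅ t₉ → t₅ ∈ terms 3 n₅ × t₉ ∈ terms 3 n₉) (sym Q/9≡3X) (sym Q/27≡X)
    (placement-3^k k n₁ n₂ n₃ n₅ n₉ weighted′ (count-of-parts k n₁ n₂ n₃ n₅ n₉ P expansions↭ sum-P≡2) powers∈)
  where
  X = 3 ^ k
  Q≡27X : 3 ^ (3 + k) ≡ 27 * X
  Q≡27X = ^-distribˡ-+-* 3 3 k
  weighted′ : n₁ + 2 * n₂ + 3 * n₃ + 5 * n₅ + 9 * n₉ + 1 ≡ 27 * X
  weighted′ = trans (cong (_+ 1) weighted) (trans (m∸n+n≡m (m^n>0 3 (3 + k))) Q≡27X)
  powers∈ : ∀ {i} → i < suc k → 3 ^ suc i ∈ expansions n₁ n₂ n₃ n₅ n₉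
  powers∈ i<1+k = ∈-resp-↭ (↭-sym expansions↭) (∈-++⁺ˡ (∈-map⁺ (λ i → 3 ^ suc i) (∈-upTo⁺ i<1+k)))
  Q/9≡3X : 3 ^ (3 + k) / 9 ≡ 3 * X
  Q/9≡3X = trans (cong (_/ 9) (trans (^-distribˡ-+-* 3 2 (suc k)) (*-comm 9 (3 * X)))) (m*n/n≡m (3 * X) 9)
  Q/27≡X : 3 ^ (3 + k) / 27 ≡ X
  Q/27≡X = trans (cong (_/ 27) (trans Q≡27X (*-comm 27 X))) (m*n/n≡m X 27)
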